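{- Let $G$ be a directed graph and $u,v$ two distinct vertices of $G$. Let $G_{u\#v}$ be the directed graph obtained from $G$ by identifying $u$ and $v$ into a single vertex, and identify $\mathbb{Z}[E(G)]=\mathbb{Z}[E(G_{u\#v})]$ via the natural bijection of edges. Under this identification there is a surjective $\mathbb{Z}[E(G)]$-module homomorphism $\mathscr H_0(G_{u\#v})\to\mathscr H_0(G)$.
   Context: A directed graph $H$: finite sets $V(H)$, $E(H)$, each edge with an initial and a terminal vertex; loops and multiple edges allowed. $\mathbb{Z}[E(H)]$ is graded with edges of degree $1$. For a vertex $w$ with outgoing edges $x_1,\dots,x_m$ and incoming edges $y_1,\dots,y_n$ (loops in both lists), $k_w=\max\{m,n\}$, $\delta_{w,l}=e_l(x_1,\dots,x_m)-e_l(y_1,\dots,y_n)$, $1\le l\le k_w$ ($e_l$ elementary symmetric); $\Delta_H$ lists all these. For homogeneous $r$ in a graded commutative ring $R$, $C^R(r)$ is $0\to R\{\deg r\}\xrightarrow{r}R\to0$ (homological degrees $1,0$) and $C^R(r_1,\dots,r_k)=\bigotimes_R C^R(r_i)$. $\mathscr H_0(H)$ is the $0$-th homology of $C^{\mathbb{Z}[E(H)]}_*(\Delta_H)$. -}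

module Defs where

open import Level using (0ℓ)
open import Data.Nat using (ℕ; zero; suc; _⊔_)
open import Data.Fin using (Fin; punchOut; _≟_)
open import Data.List using (List; []; _∷_; map; filter; allFin; upTo; length; concatMap; zipWith; foldr)
open import Data.Product using (Σ; _×_; _,_)
open import Relation.Nullary using (yes; no)
open import Relation.Binary.PropositionalEquality using (_≡_; _≢_; refl; sym)
open import Algebra.Bundles using (CommutativeRing)

record Graph (nV nE : ℕ) : Set where
  field
    src : Fin nE → Fin nV
    tgt : Fin nE → Fin nV
open Graph public

-- The polynomial ring ℤ[x_0,…,x_{n-1}] (variables = edges).
-- Elements are ring expressions; two expressions are equal in ℤ[x]
-- iff they agree under every evaluation in every commutative ring
-- (ℤ[x] is the free commutative ring on the variables).

infixl 6 _⊕_ _⊖_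
infixl 7 _⊗_
data Poly (n : ℕ) : Set where
  var : Fin n → Poly n
  𝟘 𝟙 : Poly n
  ⊝_ : Poly n → Poly n
  _⊕_ _⊗_ : Poly n → Poly n → Poly n

_⊖_ : ∀ {n} → Poly n → Poly n → Poly n
p ⊖ q = p ⊕ (⊝ q)

module _ (R : CommutativeRing 0ℓ 0ℓ) where
  open CommutativeRing R
  ⟦_⟧ : ∀ {n} → Poly n → (Fin n → Carrier) → Carrier
  ⟦ var i ⟧ ρ = ρ i
  ⟦ 𝟘 ⟧ ρ = 0#
  ⟦ 𝟙 ⟧ ρ = 1#
  ⟦ ⊝ p ⟧ ρ = - ⟦ p ⟧ ρ
  ⟦ p ⊕ q ⟧ ρ = ⟦ p ⟧ ρ + ⟦ q ⟧ ρ
  ⟦ p ⊗ q ⟧ ρ = ⟦ p ⟧ ρ * ⟦ q ⟧ ρ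

_≈P_ : ∀ {n} → Poly n → Poly n → Set₁
p ≈P q = ∀ (R : CommutativeRing 0ℓ 0ℓ) (ρ : Fin _ → CommutativeRing.Carrier R) →
  CommutativeRing._≈_ R (⟦ R ⟧ p ρ) (⟦ R ⟧ q ρ)

esym : ∀ {n} → ℕ → List (Poly n) → Poly n
esym zero    _        = 𝟙
esym (suc l) []       = 𝟘
esym (suc l) (z ∷ zs) = z ⊗ esym l zs ⊕ esym (suc l) zs

module _ {nV nE : ℕ} (H : Graph nV nE) where
  outEdges inEdges : Fin nV → List (Poly nE)
  outEdges w = map var (filter (λ x → src H x ≟ w) (allFin nE))
  inEdges  w = map var (filter (λ y → tgt H y ≟ w) (allFin nE))

  kv : Fin nV → ℕ
  kv w = length (outEdges w) ⊔ length (inEdges w)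

  δs : Fin nV → List (Poly nE)
  δs w = map (λ l → esym l (outEdges w) ⊖ esym l (inEdges w)) (map suc (upTo (kv w)))

  Δ : List (Poly nE)
  Δ = concatMap δs (allFin nV)

-- H_0 of the Koszul complex C(Δ_H) over R = ℤ[E(H)]:
-- C_1 = ⊕_i R{deg δ_i}, C_0 = R, d_1(a_1,…,a_k) = Σ a_i δ_i, d_0 = 0,
-- so H_0 = R / im d_1.  We present H_0 as the setoid on R given by
-- p ∼ q  iff  p - q = d_1(a) for some a ∈ C_1.
-- (zipWith truncates; missing coefficients count as 0, extra are ignored.)

d₁ : ∀ {n} → List (Poly n) → List (Poly n) → Poly n
d₁ as δ = foldr _⊕_ 𝟘 (zipWith _⊗_ as δ)

H₀-rel : ∀ {nV nE} → Graph nV nE → Poly nE → Poly nE → Set₁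
H₀-rel H p q = Σ (List (Poly _)) λ as → (p ⊖ q) ≈P d₁ as (Δ H)

-- G_{u#v}: identify u and v (u ≢ v).  The new vertex set is
-- V(G) ∖ {v} ≅ Fin nV (via punchOut at v); v is sent to the image of u.
-- Edges are the same (natural bijection = identity on Fin nE).

mergeV : ∀ {nV} (u v : Fin (suc nV)) → u ≢ v → Fin (suc nV) → Fin nV
mergeV u v u≢v w with w ≟ v
... | yes _  = punchOut {i = v} {j = u} (λ e → u≢v (sym e))
... | no w≢v = punchOut {i = v} {j = w} (λ e → w≢v (sym e))

identify : ∀ {nV nE} → Graph (suc nV) nE → (u v : Fin (suc nV)) → u ≢ v → Graph nV nE
src (identify G u v u≢v) x = mergeV u v u≢v (src G x)
tgt (identify G u v u≢v) x = mergeV u v u≢v (tgt G x)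

-- A ℤ[E]-module homomorphism H_0(H) → H_0(H'), presented on representatives.

IsH₀Hom : ∀ {nV nV' nE} (H : Graph nV nE) (H' : Graph nV' nE) → (Poly nE → Poly nE) → Set₁
IsH₀Hom H H' f =
  (∀ p q → H₀-rel H p q → H₀-rel H' (f p) (f q)) ×
  (∀ p q → H₀-rel H' (f (p ⊕ q)) (f p ⊕ f q)) ×
  (∀ r p → H₀-rel H' (f (r ⊗ p)) (r ⊗ f p))

IsSurjH₀ : ∀ {nV' nE} (H' : Graph nV' nE) → (Poly nE → Poly nE) → Set₁
IsSurjH₀ H' f = ∀ q → Σ (Poly _) λ p → H₀-rel H' (f p) q

-- Take the identity of ℤ[E].  It descends to a map H₀(G_{u#v}) → H₀(G), automatically
-- surjective and linear, once every relation of Δ_{G_{u#v}} lies in the ideal generated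
-- by Δ_G.  At an unmerged vertex the relations are literally those of G.  At the merged
-- vertex the outgoing (incoming) edges are those of u followed by those of v, so
-- e_l(out) = Σ_{i+j=l} e_i(out_u) e_j(out_v) and likewise for in; since
-- e_i(out_w) ≡ e_i(in_w) modulo Δ_G for every i and w (for i = 0 and i > k_w both sides
-- are 1 or 0), the two convolutions are congruent modulo Δ_G.
module Submission where

open import Defs
open import Level using (Level; 0ℓ; _⊔_) renaming (suc to lsuc)
open import Algebra.Bundles using (CommutativeRing)
open import Data.Nat using (ℕ; zero; suc; s≤s)
import Data.Nat as N
import Data.Nat.Properties as NP
open import Data.Fin using (Fin; punchIn; _≟_)
open import Data.Fin.Properties using (punchInᵢ≢i; punchOut-cong; punchOut-punchIn; punchIn-punchOut)
open import Data.Product using (Σ; _×_; _,_; proj₁; proj₂)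
open import Data.Sum as Sum using (_⊎_; inj₁; inj₂; [_,_])
open import Data.Empty using (⊥-elim)
open import Data.List using (List; []; _∷_; _++_; map; length; zipWith; foldr; filter; allFin)
open import Data.List.Properties using (filter-≐; map-++)
open import Data.List.Relation.Unary.Any using (here; there)
open import Data.List.Relation.Unary.All as All using (All; []; _∷_)
import Data.List.Relation.Unary.All.Properties as AllP
open import Data.List.Membership.Propositional using (_∈_)
open import Data.List.Membership.Propositional.Properties using (∈-map⁺; ∈-concat⁺′; ∈-upTo⁺; ∈-allFin)
open import Data.List.Relation.Binary.Permutation.Propositional
  using (_↭_; prep; swap; ↭-sym; module PermutationReasoning) renaming (refl to ↭-refl; trans to ↭-trans)
open import Data.List.Relation.Binary.Permutation.Propositional.Properties using (shift; map⁺)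
open import Function using (id; _∘_)
open import Relation.Nullary using (yes; no)
open import Relation.Unary using (Pred; Decidable; _≐_; _∪_; _⊥_)
open import Relation.Binary.PropositionalEquality using (_≡_; _≢_)
import Relation.Binary.PropositionalEquality as ≡

-- _≈P_ unfolds to a Π-type, from which Agda cannot infer the two sides.
infix 4 _≈ₚ_
record _≈ₚ_ {n : ℕ} (p q : Poly n) : Set₁ where
  constructor ⟨_⟩
  field get : p ≈P q

polyRing : ℕ → CommutativeRing 0ℓ (lsuc 0ℓ)
polyRing n = record
  { Carrier = Poly n
  ; _≈_ = _≈ₚ_
  ; _+_ = _⊕_
  ; _*_ = _⊗_
  ; -_ = ⊝_
  ; 0# = 𝟘
  ; 1# = 𝟙
  ; isCommutativeRing = record
    { isRing = record
      { +-isAbelianGroup = record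
        { isGroup = record
          { isMonoid = record
            { isSemigroup = record
              { isMagma = record
                { isEquivalence = record
                  { refl = ⟨ (λ R ρ → R.refl R) ⟩
                  ; sym = λ p → ⟨ (λ R ρ → R.sym R (get p R ρ)) ⟩
                  ; trans = λ p q → ⟨ (λ R ρ → R.trans R (get p R ρ) (get q R ρ)) ⟩
                  }
                ; ∙-cong = λ p q → ⟨ (λ R ρ → R.+-cong R (get p R ρ) (get q R ρ)) ⟩
                }
              ; assoc = λ x y z → ⟨ (λ R ρ → R.+-assoc R _ _ _) ⟩
              }
            ; identity = (λ x → ⟨ (λ R ρ → R.+-identityˡ R _) ⟩) , (λ x → ⟨ (λ R ρ → R.+-identityʳ R _) ⟩)
            }
          ; inverse = (λ x → ⟨ (λ R ρ → R.-‿inverseˡ R _) ⟩) , (λ x → ⟨ (λ R ρ → R.-‿inverseʳ R _) ⟩)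
          ; ⁻¹-cong = λ p → ⟨ (λ R ρ → R.-‿cong R (get p R ρ)) ⟩
          }
        ; comm = λ x y → ⟨ (λ R ρ → R.+-comm R _ _) ⟩
        }
      ; *-cong = λ p q → ⟨ (λ R ρ → R.*-cong R (get p R ρ) (get q R ρ)) ⟩
      ; *-assoc = λ x y z → ⟨ (λ R ρ → R.*-assoc R _ _ _) ⟩
      ; *-identity = (λ x → ⟨ (λ R ρ → R.*-identityˡ R _) ⟩) , (λ x → ⟨ (λ R ρ → R.*-identityʳ R _) ⟩)
      ; distrib = (λ x y z → ⟨ (λ R ρ → R.distribˡ R _ _ _) ⟩) , (λ x y z → ⟨ (λ R ρ → R.distribʳ R _ _ _) ⟩)
      }
    ; *-comm = λ x y → ⟨ (λ R ρ → R.*-comm R _ _) ⟩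
    }
  }
  where
  module R = CommutativeRing
  open _≈ₚ_

module IdealOf {c ℓ : Level} (R : CommutativeRing c ℓ) where
  open CommutativeRing R
  open import Relation.Binary.Reasoning.Setoid setoid
  open import Algebra.Properties.Ring ring using (-‿distribˡ-*; -‿distribʳ-*)
  open import Algebra.Properties.CommutativeSemigroup +-commutativeSemigroup using (interchange)
  open import Algebra.Properties.AbelianGroup +-abelianGroup using (⁻¹-∙-comm)

  linComb : List Carrier → List Carrier → Carrier
  linComb as δ = foldr _+_ 0# (zipWith _*_ as δ)

  infix 4 _∈⟨_⟩ _~[_]_
  _∈⟨_⟩ : Carrier → List Carrier → Set (c ⊔ ℓ)
  x ∈⟨ δ ⟩ = Σ (List Carrier) λ as → x ≈ linComb as δ

  _~[_]_ : Carrier → List Carrier → Carrier → Set (c ⊔ ℓ)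
  x ~[ δ ] y = x - y ∈⟨ δ ⟩

  addCoeffs : List Carrier → List Carrier → List Carrier
  addCoeffs [] bs = bs
  addCoeffs (a ∷ as) [] = a ∷ as
  addCoeffs (a ∷ as) (b ∷ bs) = a + b ∷ addCoeffs as bs

  linComb-addCoeffs : ∀ δ as bs → linComb (addCoeffs as bs) δ ≈ linComb as δ + linComb bs δ
  linComb-addCoeffs [] [] bs = sym (+-identityˡ _)
  linComb-addCoeffs [] (a ∷ as) [] = sym (+-identityʳ _)
  linComb-addCoeffs [] (a ∷ as) (b ∷ bs) = sym (+-identityʳ _)
  linComb-addCoeffs (x ∷ δ) [] bs = sym (+-identityˡ _)
  linComb-addCoeffs (x ∷ δ) (a ∷ as) [] = sym (+-identityʳ _)
  linComb-addCoeffs (x ∷ δ) (a ∷ as) (b ∷ bs) = begin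
    (a + b) * x + linComb (addCoeffs as bs) δ      ≈⟨ +-cong refl (linComb-addCoeffs δ as bs) ⟩
    (a + b) * x + (linComb as δ + linComb bs δ)    ≈⟨ +-cong (distribʳ x a b) refl ⟩
    (a * x + b * x) + (linComb as δ + linComb bs δ) ≈⟨ interchange _ _ _ _ ⟩
    (a * x + linComb as δ) + (b * x + linComb bs δ) ∎

  linComb-scale : ∀ r δ as → linComb (map (r *_) as) δ ≈ r * linComb as δ
  linComb-scale r [] [] = sym (zeroʳ _)
  linComb-scale r [] (a ∷ as) = sym (zeroʳ _)
  linComb-scale r (x ∷ δ) [] = sym (zeroʳ _)
  linComb-scale r (x ∷ δ) (a ∷ as) = begin
    r * a * x + linComb (map (r *_) as) δ  ≈⟨ +-cong (*-assoc r a x) (linComb-scale r δ as) ⟩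
    r * (a * x) + r * linComb as δ        ≈⟨ distribˡ r _ _ ⟨
    r * (a * x + linComb as δ)            ∎

  module _ {δ : List Carrier} where
    ∈⟨⟩-resp-≈ : ∀ {x y} → x ≈ y → y ∈⟨ δ ⟩ → x ∈⟨ δ ⟩
    ∈⟨⟩-resp-≈ x≈y (as , y≈) = as , trans x≈y y≈

    0∈⟨⟩ : 0# ∈⟨ δ ⟩
    0∈⟨⟩ = [] , refl

    +-∈⟨⟩ : ∀ {x y} → x ∈⟨ δ ⟩ → y ∈⟨ δ ⟩ → x + y ∈⟨ δ ⟩
    +-∈⟨⟩ (as , x≈) (bs , y≈) = addCoeffs as bs , trans (+-cong x≈ y≈) (sym (linComb-addCoeffs δ as bs))

    *-∈⟨⟩ˡ : ∀ r {x} → x ∈⟨ δ ⟩ → r * x ∈⟨ δ ⟩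
    *-∈⟨⟩ˡ r (as , x≈) = map (r *_) as , trans (*-cong refl x≈) (sym (linComb-scale r δ as))

    *-∈⟨⟩ʳ : ∀ r {x} → x ∈⟨ δ ⟩ → x * r ∈⟨ δ ⟩
    *-∈⟨⟩ʳ r x∈ = ∈⟨⟩-resp-≈ (*-comm _ r) (*-∈⟨⟩ˡ r x∈)

  ∈⇒∈⟨⟩ : ∀ {δ x} → x ∈ δ → x ∈⟨ δ ⟩
  ∈⇒∈⟨⟩ (here ≡.refl) = 1# ∷ [] , sym (trans (+-identityʳ _) (*-identityˡ _))
  ∈⇒∈⟨⟩ (there x∈δ) with ∈⇒∈⟨⟩ x∈δ
  ... | as , x≈ = 0# ∷ as , trans x≈ (sym (trans (+-cong (zeroˡ _) refl) (+-identityˡ _)))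

  ∈⟨⟩-mono : ∀ {γ δ x} → All (_∈⟨ δ ⟩) γ → x ∈⟨ γ ⟩ → x ∈⟨ δ ⟩
  ∈⟨⟩-mono {γ} γ⊆ (as , x≈) = ∈⟨⟩-resp-≈ x≈ (linComb-∈⟨⟩ γ⊆ as)
    where
    linComb-∈⟨⟩ : ∀ {γ} → All (_∈⟨ _ ⟩) γ → ∀ as → linComb as γ ∈⟨ _ ⟩
    linComb-∈⟨⟩ [] [] = 0∈⟨⟩
    linComb-∈⟨⟩ [] (a ∷ as) = 0∈⟨⟩
    linComb-∈⟨⟩ (g ∷ gs) [] = 0∈⟨⟩
    linComb-∈⟨⟩ (g ∷ gs) (a ∷ as) = +-∈⟨⟩ (*-∈⟨⟩ˡ a g) (linComb-∈⟨⟩ gs as)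

  module _ {δ : List Carrier} where
    ~-refl : ∀ {x} → x ~[ δ ] x
    ~-refl = ∈⟨⟩-resp-≈ (-‿inverseʳ _) 0∈⟨⟩

    ~-resp-≈ : ∀ {x x' y y'} → x ≈ x' → y ≈ y' → x' ~[ δ ] y' → x ~[ δ ] y
    ~-resp-≈ x≈ y≈ = ∈⟨⟩-resp-≈ (+-cong x≈ (-‿cong y≈))

    +-cong-~ : ∀ {a b c d} → a ~[ δ ] c → b ~[ δ ] d → a + b ~[ δ ] c + d
    +-cong-~ a~c b~d = ∈⟨⟩-resp-≈
      (trans (+-cong refl (sym (⁻¹-∙-comm _ _))) (interchange _ _ _ _))
      (+-∈⟨⟩ a~c b~d)

    *-cong-~ : ∀ {a b c d} → a ~[ δ ] c → b ~[ δ ] d → a * b ~[ δ ] c * d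
    *-cong-~ {a} {b} {c} {d} a~c b~d = ∈⟨⟩-resp-≈ (sym split) (+-∈⟨⟩ (*-∈⟨⟩ʳ b a~c) (*-∈⟨⟩ˡ c b~d))
      where
      split : (a - c) * b + c * (b - d) ≈ a * b - c * d
      split = begin
        (a - c) * b + c * (b - d)
          ≈⟨ +-cong (distribʳ b a (- c)) (distribˡ c b (- d)) ⟩
        (a * b + (- c) * b) + (c * b + c * (- d))
          ≈⟨ +-cong (+-cong refl (sym (-‿distribˡ-* c b))) (+-cong refl (sym (-‿distribʳ-* c d))) ⟩
        (a * b - c * b) + (c * b - c * d)
          ≈⟨ trans (+-assoc _ _ _) (+-cong refl (sym (+-assoc _ _ _))) ⟩
        a * b + ((- (c * b) + c * b) - c * d)
          ≈⟨ sym (+-assoc _ _ _) ⟩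
        a * b + (- (c * b) + c * b) - c * d
          ≈⟨ +-cong (trans (+-cong refl (-‿inverseˡ _)) (+-identityʳ _)) refl ⟩
        a * b - c * d ∎

module Convolution {c ℓ : Level} (R : CommutativeRing c ℓ) where
  open CommutativeRing R
  open IdealOf R
  open import Relation.Binary.Reasoning.Setoid setoid
  open import Algebra.Properties.CommutativeSemigroup +-commutativeSemigroup using (interchange)

  conv : (ℕ → Carrier) → (ℕ → Carrier) → ℕ → Carrier
  conv a b zero = a 0 * b 0
  conv a b (suc l) = a 0 * b (suc l) + conv (a ∘ suc) b l

  conv-zeroˡ : ∀ b l → conv (λ _ → 0#) b l ≈ 0#
  conv-zeroˡ b zero = zeroˡ _
  conv-zeroˡ b (suc l) = trans (+-cong (zeroˡ _) (conv-zeroˡ b l)) (+-identityʳ 0#)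

  conv-linearˡ : ∀ x a a' b l → conv (λ i → x * a i + a' i) b l ≈ x * conv a b l + conv a' b l
  conv-linearˡ x a a' b zero = trans (distribʳ _ _ _) (+-cong (*-assoc _ _ _) refl)
  conv-linearˡ x a a' b (suc l) = begin
    (x * a 0 + a' 0) * b (suc l) + conv (λ i → x * a (suc i) + a' (suc i)) b l
      ≈⟨ +-cong refl (conv-linearˡ x (a ∘ suc) (a' ∘ suc) b l) ⟩
    (x * a 0 + a' 0) * b (suc l) + (x * conv (a ∘ suc) b l + conv (a' ∘ suc) b l)
      ≈⟨ +-cong (trans (distribʳ _ _ _) (+-cong (*-assoc _ _ _) refl)) refl ⟩
    (x * (a 0 * b (suc l)) + a' 0 * b (suc l)) + (x * conv (a ∘ suc) b l + conv (a' ∘ suc) b l)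
      ≈⟨ interchange _ _ _ _ ⟩
    (x * (a 0 * b (suc l)) + x * conv (a ∘ suc) b l) + (a' 0 * b (suc l) + conv (a' ∘ suc) b l)
      ≈⟨ +-cong (distribˡ x _ _) refl ⟨
    x * (a 0 * b (suc l) + conv (a ∘ suc) b l) + (a' 0 * b (suc l) + conv (a' ∘ suc) b l) ∎

  conv-cong-~ : ∀ {δ a b a' b'} → (∀ i → a i ~[ δ ] a' i) → (∀ j → b j ~[ δ ] b' j) →
                ∀ l → conv a b l ~[ δ ] conv a' b' l
  conv-cong-~ a~ b~ zero = *-cong-~ (a~ 0) (b~ 0)
  conv-cong-~ a~ b~ (suc l) = +-cong-~ (*-cong-~ (a~ 0) (b~ (suc l))) (conv-cong-~ (a~ ∘ suc) b~ l)

module _ {n : ℕ} where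
  open CommutativeRing (polyRing n)
  open Convolution (polyRing n)
  open import Relation.Binary.Reasoning.Setoid setoid
  open import Algebra.Properties.CommutativeSemigroup +-commutativeSemigroup using (x∙yz≈y∙xz; interchange)
  open import Algebra.Properties.CommutativeSemigroup *-commutativeSemigroup using () renaming (x∙yz≈y∙xz to x*yz≈y*xz)

  esym-∷-cong : ∀ x {xs ys : List (Poly n)} → (∀ l → esym l xs ≈ esym l ys) →
                ∀ l → esym l (x ∷ xs) ≈ esym l (x ∷ ys)
  esym-∷-cong x eq zero = refl
  esym-∷-cong x eq (suc l) = +-cong (*-cong refl (eq l)) (eq (suc l))

  esym-swap : ∀ x y xs l → esym l (x ∷ y ∷ xs) ≈ esym l (y ∷ x ∷ xs)
  esym-swap x y xs zero = refl
  esym-swap x y xs (suc zero) = x∙yz≈y∙xz _ _ _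
  esym-swap x y xs (suc (suc l)) = begin
    x * (y * e + d) + (y * d + e')       ≈⟨ +-cong (distribˡ x _ _) refl ⟩
    (x * (y * e) + x * d) + (y * d + e') ≈⟨ interchange _ _ _ _ ⟩
    (x * (y * e) + y * d) + (x * d + e') ≈⟨ +-cong (+-cong (x*yz≈y*xz x y e) refl) refl ⟩
    (y * (x * e) + y * d) + (x * d + e') ≈⟨ +-cong (distribˡ y _ _) refl ⟨
    y * (x * e + d) + (x * d + e')       ∎
    where
    e d e' : Poly n
    e = esym l xs
    d = esym (suc l) xs
    e' = esym (suc (suc l)) xs

  esym-↭ : ∀ {xs ys : List (Poly n)} → xs ↭ ys → ∀ l → esym l xs ≈ esym l ys
  esym-↭ ↭-refl = λ _ → refl
  esym-↭ (prep x p) = esym-∷-cong x (esym-↭ p)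
  esym-↭ (swap x y p) l = trans (esym-∷-cong x (esym-∷-cong y (esym-↭ p)) l) (esym-swap x y _ l)
  esym-↭ (↭-trans p q) l = trans (esym-↭ p l) (esym-↭ q l)

  length<⇒esym≈0 : ∀ {l} (xs : List (Poly n)) → length xs N.< l → esym l xs ≈ 0#
  length<⇒esym≈0 {suc l} [] _ = refl
  length<⇒esym≈0 {suc (suc l)} (x ∷ xs) (s≤s |xs|<l) =
    trans (+-cong (*-cong refl (length<⇒esym≈0 xs |xs|<l)) (length<⇒esym≈0 xs (NP.m<n⇒m<1+n |xs|<l)))
          (trans (+-identityʳ _) (zeroʳ x))

  esym-++ : ∀ (xs ys : List (Poly n)) l → esym l (xs ++ ys) ≈ conv (λ i → esym i xs) (λ j → esym j ys) l
  esym-++ [] ys zero = sym (*-identityˡ _)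
  esym-++ [] ys (suc l) = sym (trans (+-cong (*-identityˡ _) (conv-zeroˡ _ l)) (+-identityʳ _))
  esym-++ (x ∷ xs) ys zero = sym (*-identityˡ _)
  esym-++ (x ∷ xs) ys (suc l) = begin
    x * esym l (xs ++ ys) + esym (suc l) (xs ++ ys)
      ≈⟨ +-cong (*-cong refl (esym-++ xs ys l)) (esym-++ xs ys (suc l)) ⟩
    x * conv exs eys l + (𝟙 * eys (suc l) + conv (exs ∘ suc) eys l)
      ≈⟨ x∙yz≈y∙xz _ _ _ ⟩
    𝟙 * eys (suc l) + (x * conv exs eys l + conv (exs ∘ suc) eys l)
      ≈⟨ +-cong refl (conv-linearˡ x exs (exs ∘ suc) eys l) ⟨
    𝟙 * eys (suc l) + conv (λ i → x * exs i + exs (suc i)) eys l ∎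
    where
    exs eys : ℕ → Poly n
    exs i = esym i xs
    eys j = esym j ys

filter-↭-++ : ∀ {A : Set} {S P Q : Pred A 0ℓ} (S? : Decidable S) (P? : Decidable P) (Q? : Decidable Q) →
              S ≐ P ∪ Q → P ⊥ Q → ∀ xs → filter S? xs ↭ filter P? xs ++ filter Q? xs
filter-↭-++ S? P? Q? S≐P∪Q P⊥Q [] = ↭-refl
filter-↭-++ S? P? Q? S≐P∪Q P⊥Q (x ∷ xs) with S? x | P? x | Q? x
... | yes _  | yes p | no _  = prep x (filter-↭-++ S? P? Q? S≐P∪Q P⊥Q xs)
... | yes _  | no _  | yes _ = ↭-trans (prep x (filter-↭-++ S? P? Q? S≐P∪Q P⊥Q xs)) (↭-sym (shift x _ _))
... | no _   | no _  | no _  = filter-↭-++ S? P? Q? S≐P∪Q P⊥Q xs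
... | _      | yes p | yes q = ⊥-elim (P⊥Q (p , q))
... | yes s  | no ¬p | no ¬q = ⊥-elim ([ ¬p , ¬q ] (proj₁ S≐P∪Q s))
... | no ¬s  | yes p | _     = ⊥-elim (¬s (proj₂ S≐P∪Q (inj₁ p)))
... | no ¬s  | _     | yes q = ⊥-elim (¬s (proj₂ S≐P∪Q (inj₂ q)))

-- outEdges H = edgesAt (src H) and inEdges H = edgesAt (tgt H) definitionally.
edgesAt : ∀ {nV nE} → (Fin nE → Fin nV) → Fin nV → List (Poly nE)
edgesAt {nE = nE} s w = map var (filter (λ x → s x ≟ w) (allFin nE))

module Merge {nV : ℕ} (u v : Fin (suc nV)) (u≢v : u ≢ v) where
  mergeV-punchIn : ∀ w' → mergeV u v u≢v (punchIn v w') ≡ w'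
  mergeV-punchIn w' with punchIn v w' ≟ v
  ... | yes eq = ⊥-elim (punchInᵢ≢i v w' eq)
  ... | no _  = ≡.trans (punchOut-cong v ≡.refl) (punchOut-punchIn v)

  mergeV-v : mergeV u v u≢v v ≡ mergeV u v u≢v u
  mergeV-v with v ≟ v | u ≟ v
  ... | no v≢v | _     = ⊥-elim (v≢v ≡.refl)
  ... | yes _  | yes u≡v = ⊥-elim (u≢v u≡v)
  ... | yes _  | no _  = punchOut-cong v ≡.refl

  mergeV-fiber : ∀ s w' → mergeV u v u≢v s ≡ w' → s ≡ punchIn v w' ⊎ (s ≡ v × u ≡ punchIn v w')
  mergeV-fiber s w' eq with s ≟ v
  ... | yes s≡v = inj₂ (s≡v , ≡.trans (≡.sym (punchIn-punchOut _)) (≡.cong (punchIn v) eq))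
  ... | no _    = inj₁ (≡.trans (≡.sym (punchIn-punchOut _)) (≡.cong (punchIn v) eq))

  module _ {nE : ℕ} (s : Fin nE → Fin (suc nV)) (w' : Fin nV) where
    edgesAt-merge-≢ : u ≢ punchIn v w' → edgesAt (mergeV u v u≢v ∘ s) w' ≡ edgesAt s (punchIn v w')
    edgesAt-merge-≢ u≢w = ≡.cong (map var) (filter-≐ _ _ (merged⊆ , unmerged⊆) (allFin nE))
      where
      merged⊆ : ∀ {x} → mergeV u v u≢v (s x) ≡ w' → s x ≡ punchIn v w'
      merged⊆ {x} eq with mergeV-fiber (s x) w' eq
      ... | inj₁ sx≡w = sx≡w
      ... | inj₂ (_ , u≡w) = ⊥-elim (u≢w u≡w)
      unmerged⊆ : ∀ {x} → s x ≡ punchIn v w' → mergeV u v u≢v (s x) ≡ w'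
      unmerged⊆ eq = ≡.trans (≡.cong (mergeV u v u≢v) eq) (mergeV-punchIn w')

    edgesAt-merge-≡ : u ≡ punchIn v w' →
      edgesAt (mergeV u v u≢v ∘ s) w' ↭ edgesAt s (punchIn v w') ++ edgesAt s v
    edgesAt-merge-≡ u≡w = begin
      map var (filter merged? (allFin nE))                          ↭⟨ map⁺ var (filter-↭-++ merged? atW? atV? fiber-≐ disjoint (allFin nE)) ⟩
      map var (filter atW? (allFin nE) ++ filter atV? (allFin nE)) ≡⟨ map-++ var (filter atW? (allFin nE)) (filter atV? (allFin nE)) ⟩
      edgesAt s (punchIn v w') ++ edgesAt s v                       ∎
      where
      open PermutationReasoning
      merged? atW? atV? : Decidable _
      merged? x = mergeV u v u≢v (s x) ≟ w'
      atW? x = s x ≟ punchIn v w'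
      atV? x = s x ≟ v
      v↦w : mergeV u v u≢v v ≡ w'
      v↦w = ≡.trans mergeV-v (≡.trans (≡.cong (mergeV u v u≢v) u≡w) (mergeV-punchIn w'))
      fiber-≐ : (λ x → mergeV u v u≢v (s x) ≡ w') ≐ (λ x → s x ≡ punchIn v w') ∪ (λ x → s x ≡ v)
      fiber-≐ = (λ {x} eq → Sum.map₂ proj₁ (mergeV-fiber (s x) w' eq))
              , [ (λ eq → ≡.trans (≡.cong (mergeV u v u≢v) eq) (mergeV-punchIn w'))
                , (λ eq → ≡.trans (≡.cong (mergeV u v u≢v) eq) v↦w) ]
      disjoint : (λ x → s x ≡ punchIn v w') ⊥ (λ x → s x ≡ v)
      disjoint (sx≡w , sx≡v) = punchInᵢ≢i v w' (≡.trans (≡.sym sx≡w) sx≡v)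

module _ {nV nE : ℕ} (H : Graph nV nE) where
  open IdealOf (polyRing nE)

  -- Also for l = 0, and for l > k_w, where both sides vanish.
  esym-out~esym-in : ∀ w l → esym l (outEdges H w) ~[ Δ H ] esym l (inEdges H w)
  esym-out~esym-in w zero = ~-refl
  esym-out~esym-in w (suc j) with j NP.<? kv H w
  ... | yes j<k = ∈⇒∈⟨⟩ (∈-concat⁺′ (∈-map⁺ _ (∈-map⁺ suc (∈-upTo⁺ j<k))) (∈-map⁺ (δs H) (∈-allFin w)))
  ... | no j≮k = ~-resp-≈ (length<⇒esym≈0 (outEdges H w) (s≤s (NP.≤-trans (NP.m≤m⊔n _ _) k≤j)))
                          (length<⇒esym≈0 (inEdges H w) (s≤s (NP.≤-trans (NP.m≤n⊔m _ _) k≤j)))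
                          ~-refl
    where k≤j = NP.≮⇒≥ j≮k

  H₀-rel⇒~ : ∀ p q → H₀-rel H p q → p ~[ Δ H ] q
  H₀-rel⇒~ p q (as , p-q≈) = as , ⟨ p-q≈ ⟩

  ~⇒H₀-rel : ∀ p q → p ~[ Δ H ] q → H₀-rel H p q
  ~⇒H₀-rel p q (as , ⟨ p-q≈ ⟩) = as , p-q≈

  H₀-rel-refl : ∀ p → H₀-rel H p p
  H₀-rel-refl p = ~⇒H₀-rel p p ~-refl

module _ {nV nE : ℕ} (G : Graph (suc nV) nE) (u v : Fin (suc nV)) (u≢v : u ≢ v) where
  open CommutativeRing (polyRing nE) using (trans; reflexive)
  open IdealOf (polyRing nE)
  open Convolution (polyRing nE)
  open Merge u v u≢v

  private
    G' : Graph nV nE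
    G' = identify G u v u≢v

  esym-out~esym-in-identify : ∀ w' l → esym l (outEdges G' w') ~[ Δ G ] esym l (inEdges G' w')
  esym-out~esym-in-identify w' l with u ≟ punchIn v w'
  ... | no u≢w = ~-resp-≈ (reflexive (≡.cong (esym l) (edgesAt-merge-≢ (src G) w' u≢w)))
                          (reflexive (≡.cong (esym l) (edgesAt-merge-≢ (tgt G) w' u≢w)))
                          (esym-out~esym-in G (punchIn v w') l)
  ... | yes u≡w = ~-resp-≈ (trans (esym-↭ (edgesAt-merge-≡ (src G) w' u≡w) l) (esym-++ _ _ l))
                           (trans (esym-↭ (edgesAt-merge-≡ (tgt G) w' u≡w) l) (esym-++ _ _ l))
                           (conv-cong-~ (esym-out~esym-in G (punchIn v w')) (esym-out~esym-in G v) l)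

  Δ-identify⊆⟨Δ⟩ : All (_∈⟨ Δ G ⟩) (Δ G')
  Δ-identify⊆⟨Δ⟩ = AllP.concat⁺ (AllP.map⁺ (All.universal (λ w' → AllP.map⁺ (AllP.map⁺
    (All.universal (esym-out~esym-in-identify w' ∘ suc) _))) (allFin nV)))

lemma3p11 : ∀ {nV nE : ℕ} (G : Graph (suc nV) nE) (u v : Fin (suc nV)) (u≢v : u ≢ v) →
    Σ (Poly nE → Poly nE) λ f → IsH₀Hom (identify G u v u≢v) G f × IsSurjH₀ G f
lemma3p11 G u v u≢v =
  id , (well-defined , (λ p q → H₀-rel-refl G (p ⊕ q)) , (λ r p → H₀-rel-refl G (r ⊗ p))) , λ q → q , H₀-rel-refl G q
  where
  well-defined : ∀ p q → H₀-rel (identify G u v u≢v) p q → H₀-rel G p q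
  well-defined p q = ~⇒H₀-rel G p q ∘ IdealOf.∈⟨⟩-mono (polyRing _) (Δ-identify⊆⟨Δ⟩ G u v u≢v) ∘ H₀-rel⇒~ (identify G u v u≢v) p q
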